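{- Let $d\ge 1$ and $n\ge 1$ be integers. For any nonnegative integers $k$ and $\ell$, the total number of pairs $(T,v)$, where $T$ is a rooted $d$-tuplet tree with $n$ tuplets and $v$ is a vertex of $T$ of outdegree $\ge k$ and at level $\ge \ell$, equals $$d^{\ell}\binom{(d+1)n-k}{dn+\ell}.$$
   Context: A rooted $d$-tuplet tree is the following recursively defined ordered structure. It has a distinguished vertex, the root. Each vertex $u$ has a (possibly empty) linearly ordered list of tuplets attached below it (pointing away from the root). Each tuplet attached at $u$ consists of $u$ together with a linearly ordered list of exactly $d$ new vertices, called the children of $u$ in that tuplet, and each of these is again the top of such a structure. Equivalently, it is a rooted plane tree in which the children of every vertex are grouped, left to right, into consecutive blocks of size $d$. Geometrically, each tuplet is a $(d+1)$-gon glued at $u$. The number of tuplets is the total number of such blocks. The number of rooted $d$-tuplet trees with $n$ tuplets is $\frac{1}{dn+1}\binom{(d+1)n}{n}$. The outdegree of a vertex $v$ is the number of tuplets attached below $v$. The level of $v$ is the number of tuplets on the path from the root to $v$, so the root has level $0$. -}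

module Defs where

open import Data.Nat using (ℕ; zero; suc; _+_; _≤?_)
open import Data.List using (List; []; _∷_; _++_; length; filter; sum; map)
open import Data.Vec using (Vec; []; _∷_)
open import Data.Product using (_×_; _,_; proj₁; proj₂)
open import Relation.Nullary.Decidable using (_×-dec_)

-- A rooted d-tuplet tree: the root carries an ordered list of tuplets,
-- each tuplet being an ordered vector of exactly d child subtrees.
data Tree (d : ℕ) : Set where
  node : List (Vec (Tree d) d) → Tree d

mutual
  tuplets : ∀ {d} → Tree d → ℕ
  tuplets (node ts) = tupletsL ts

  tupletsL : ∀ {d} → List (Vec (Tree d) d) → ℕ
  tupletsL [] = 0
  tupletsL (v ∷ ts) = suc (tupletsV v + tupletsL ts)

  tupletsV : ∀ {d m} → Vec (Tree d) m → ℕ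
  tupletsV [] = 0
  tupletsV (t ∷ v) = tuplets t + tupletsV v

-- list of all vertices of a tree, each recorded as (outdegree , level),
-- where the top vertex is given level l.  Children in a tuplet below u
-- have level (level of u) + 1.
mutual
  vertices : ∀ {d} → Tree d → ℕ → List (ℕ × ℕ)
  vertices (node ts) l = (length ts , l) ∷ verticesL ts (suc l)

  verticesL : ∀ {d} → List (Vec (Tree d) d) → ℕ → List (ℕ × ℕ)
  verticesL [] l = []
  verticesL (v ∷ ts) l = verticesV v l ++ verticesL ts l

  verticesV : ∀ {d m} → Vec (Tree d) m → ℕ → List (ℕ × ℕ)
  verticesV [] l = []
  verticesV (t ∷ v) l = vertices t l ++ verticesV v l

countVerts : ∀ {d} → ℕ → ℕ → Tree d → ℕ
countVerts k ℓ T =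
  length (filter (λ p → (k ≤? proj₁ p) ×-dec (ℓ ≤? proj₂ p)) (vertices T 0))

-- A forest (a vector of trees) with p + 1 tuplets either starts with a leaf, or it arises from a
-- forest with p tuplets and d more trees by grafting the last d trees as a new first tuplet of the
-- first tree.  For a statistic of the tree at a fixed position, the sum over all forests with
-- a + 1 trees and p tuplets therefore satisfies the Pascal-type recurrence of this decomposition
-- at every position but the first, and once its value at the first position is known by induction
-- on p, it is the same at every position.  Going down one level means choosing one of d children
-- below a tuplet, which turns the forest into one with d + 1 more trees and one tuplet fewer, and
-- an outdegree of at least k uses up k tuplets, each leaving d more trees.  So the count of
-- vertices of outdegree ≥ k and level ≥ ℓ is d^ℓ times the number ((d + 1) q + a choose q) of
-- forests with a marked vertex in the first tree, shifted ℓ times by d + 1 trees and k times by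
-- d trees; for a single tree this is the binomial coefficient of the theorem.
module Submission where

open import Defs
open import Data.Nat using (ℕ; zero; suc; _+_; _*_; _∸_; _^_; _≤_; _<_; _≤?_; z≤n; s≤s; >-nonZero)
open import Data.Nat.Properties
open import Data.Nat.Combinatorics using (_C_; nCk+nC[k+1]≡[n+1]C[k+1]; nC1≡n; k>n⇒nCk≡0; nCk≡nC[n∸k])
open import Data.Nat.Tactic.RingSolver using (solve-∀)
open import Data.Nat.ListAction using (sum)
open import Data.Nat.ListAction.Properties using (sum-++; sum-↭)
open import Algebra.Properties.CommutativeSemigroup +-commutativeSemigroup using (interchange; xy∙z≈xz∙y)
open import Data.Empty using (⊥-elim)
open import Data.Fin using (Fin; zero; suc; _↑ˡ_; _↑ʳ_)
open import Data.Product using (_×_; _,_; proj₁; proj₂; map₂)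
open import Data.List using (List; []; _∷_; _++_; map; tabulate; length; filter)
open import Data.List.Properties using (map-++; map-∘; map-cong; length-++; length-map; tabulate-cong)
open import Data.List.Membership.Propositional using (_∈_)
open import Data.List.Membership.Propositional.Properties using (∈-map⁺; ∈-map⁻; ∈-++⁺ˡ; ∈-++⁺ʳ)
open import Data.List.Membership.Propositional.Properties.WithK using (unique∧set⇒bag)
open import Data.List.Relation.Unary.Any using (here)
open import Data.List.Relation.Unary.All as All using (All; []; _∷_)
import Data.List.Relation.Unary.All.Properties as All
open import Data.List.Relation.Unary.AllPairs using ([]; _∷_)
open import Data.List.Relation.Unary.Unique.Propositional using (Unique)
import Data.List.Relation.Unary.Unique.Propositional.Properties as Unique
open import Data.List.Relation.Binary.Disjoint.Propositional using (Disjoint)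
open import Data.List.Relation.Binary.BagAndSetEquality using (∼bag⇒↭)
open import Data.List.Relation.Binary.Permutation.Propositional.Properties using (map⁺)
open import Data.Vec as V using (Vec; []; _∷_)
open import Data.Vec.Properties
  using (take++drop≡id; ++-injective; ∷-injectiveʳ; lookup-++ˡ; lookup-++ʳ; lookup-replicate)
open import Function.Base using (_∘_)
open import Function.Bundles using (_⇔_; mk⇔)
import Function.Properties.Equivalence as ⇔
open import Level using (0ℓ)
open import Relation.Binary.PropositionalEquality
open import Relation.Nullary using (¬_; yes; no)
open import Relation.Unary using (Pred; Decidable)

module _ {A : Set} where

  sum-map-cong-set : (g : A → ℕ) {xs ys : List A} → Unique xs → Unique ys →
                     (∀ {x} → (x ∈ xs) ⇔ (x ∈ ys)) → sum (map g xs) ≡ sum (map g ys)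
  sum-map-cong-set g uxs uys xs≈ys = sum-↭ (map⁺ g (∼bag⇒↭ (unique∧set⇒bag uxs uys xs≈ys)))

  sum-map-+ : (g h : A → ℕ) (xs : List A) → sum (map (λ x → g x + h x) xs) ≡ sum (map g xs) + sum (map h xs)
  sum-map-+ g h [] = refl
  sum-map-+ g h (x ∷ xs) = trans (cong (g x + h x +_) (sum-map-+ g h xs)) (interchange (g x) (h x) _ _)

  sum-map-const : (c : ℕ) (xs : List A) → sum (map (λ _ → c) xs) ≡ c * length xs
  sum-map-const c [] = sym (*-zeroʳ c)
  sum-map-const c (x ∷ xs) = trans (cong (c +_) (sum-map-const c xs)) (sym (*-suc c (length xs)))

  sum-map-tabulate-comm : ∀ n (h : A → Fin n → ℕ) (xs : List A) →
    sum (map (λ x → sum (tabulate (h x))) xs) ≡ sum (tabulate (λ j → sum (map (λ x → h x j) xs)))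
  sum-map-tabulate-comm zero h xs = sum-map-const 0 xs
  sum-map-tabulate-comm (suc n) h xs = begin
    sum (map (λ x → h x zero + sum (tabulate (h x ∘ suc))) xs)
      ≡⟨ sum-map-+ (λ x → h x zero) (λ x → sum (tabulate (h x ∘ suc))) xs ⟩
    sum (map (λ x → h x zero) xs) + sum (map (λ x → sum (tabulate (h x ∘ suc))) xs)
      ≡⟨ cong (sum (map (λ x → h x zero) xs) +_) (sum-map-tabulate-comm n (λ x → h x ∘ suc) xs) ⟩
    sum (map (λ x → h x zero) xs) + sum (tabulate (λ j → sum (map (λ x → h x (suc j)) xs))) ∎
    where open ≡-Reasoning

sum-tabulate-const : ∀ n (c : ℕ) → sum (tabulate {n = n} (λ _ → c)) ≡ n * c
sum-tabulate-const zero c = refl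
sum-tabulate-const (suc n) c = cong (c +_) (sum-tabulate-const n c)

take-drop-++ : ∀ {A : Set} {m n} (u : Vec A m) (v : Vec A n) → V.take m (u V.++ v) ≡ u × V.drop m (u V.++ v) ≡ v
take-drop-++ {m = m} u v = ++-injective (V.take m (u V.++ v)) u (take++drop≡id m (u V.++ v))

lookup-drop : ∀ {A : Set} m {n} (w : Vec A (m + n)) (j : Fin n) → V.lookup (V.drop m w) j ≡ V.lookup w (m ↑ʳ j)
lookup-drop m w j = begin
  V.lookup (V.drop m w) j                               ≡⟨ lookup-++ʳ (V.take m w) (V.drop m w) j ⟨
  V.lookup (V.take m w V.++ V.drop m w) (m ↑ʳ j)        ≡⟨ cong (λ u → V.lookup u (m ↑ʳ j)) (take++drop≡id m w) ⟩
  V.lookup w (m ↑ʳ j)                                   ∎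
  where open ≡-Reasoning

atLeast : ℕ → ℕ → ℕ
atLeast zero    o       = 1
atLeast (suc k) zero    = 0
atLeast (suc k) (suc o) = atLeast k o

atLeast-suc : ∀ k o → atLeast k (suc o) ≡ atLeast (k ∸ 1) o
atLeast-suc zero    o = refl
atLeast-suc (suc k) o = refl

atLeast-≤ : ∀ {k o} → k ≤ o → atLeast k o ≡ 1
atLeast-≤ z≤n       = refl
atLeast-≤ (s≤s k≤o) = atLeast-≤ k≤o

atLeast-≰ : ∀ {k o} → ¬ k ≤ o → atLeast k o ≡ 0
atLeast-≰ {zero}          k≰o = ⊥-elim (k≰o z≤n)
atLeast-≰ {suc k} {zero}  k≰o = refl
atLeast-≰ {suc k} {suc o} k≰o = atLeast-≰ (k≰o ∘ s≤s)

length-filter≡sum-indicator : ∀ {A : Set} {P : Pred A 0ℓ} (P? : Decidable P) (h : A → ℕ) →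
  (∀ {x} → P x → h x ≡ 1) → (∀ {x} → ¬ P x → h x ≡ 0) → ∀ xs → length (filter P? xs) ≡ sum (map h xs)
length-filter≡sum-indicator P? h h-yes h-no [] = refl
length-filter≡sum-indicator P? h h-yes h-no (x ∷ xs) with P? x
... | yes px = cong₂ _+_ (sym (h-yes px)) (length-filter≡sum-indicator P? h h-yes h-no xs)
... | no ¬px = cong₂ _+_ (sym (h-no ¬px)) (length-filter≡sum-indicator P? h h-yes h-no xs)

-- The level factor comes first, so that for ℓ > 0 the weight of a root computes to 0.
vertexWeight : ℕ → ℕ → ℕ × ℕ → ℕ
vertexWeight k ℓ (o , l) = atLeast ℓ l * atLeast k o

weight : ℕ → ℕ → List (ℕ × ℕ) → ℕ
weight k ℓ xs = sum (map (vertexWeight k ℓ) xs)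

countVerts≡weight : ∀ {d} k ℓ (T : Tree d) → countVerts k ℓ T ≡ weight k ℓ (vertices T 0)
countVerts≡weight k ℓ T = length-filter≡sum-indicator _ (vertexWeight k ℓ) accepted rejected (vertices T 0)
  where
    accepted : ∀ {x} → k ≤ proj₁ x × ℓ ≤ proj₂ x → vertexWeight k ℓ x ≡ 1
    accepted (k≤o , ℓ≤l) = cong₂ _*_ (atLeast-≤ ℓ≤l) (atLeast-≤ k≤o)
    rejected : ∀ {x} → ¬ (k ≤ proj₁ x × ℓ ≤ proj₂ x) → vertexWeight k ℓ x ≡ 0
    rejected {o , l} ¬both with k ≤? o
    ... | yes k≤o = cong (_* atLeast k o) (atLeast-≰ (λ ℓ≤l → ¬both (k≤o , ℓ≤l)))
    ... | no  k≰o = trans (cong (atLeast ℓ l *_) (atLeast-≰ k≰o)) (*-zeroʳ (atLeast ℓ l))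

[k+1]*[n+1]C[k+1]≡[n+1]*nCk : ∀ n k → suc k * (suc n C suc k) ≡ suc n * (n C k)
[k+1]*[n+1]C[k+1]≡[n+1]*nCk zero    zero    = refl
[k+1]*[n+1]C[k+1]≡[n+1]*nCk zero    (suc k) =
  trans (cong (suc (suc k) *_) (k>n⇒nCk≡0 {1} {suc (suc k)} (s≤s (s≤s z≤n)))) (*-zeroʳ (suc (suc k)))
[k+1]*[n+1]C[k+1]≡[n+1]*nCk (suc n) zero    = trans (+-identityʳ _) (trans (nC1≡n (suc (suc n))) (sym (*-identityʳ _)))
[k+1]*[n+1]C[k+1]≡[n+1]*nCk (suc n) (suc k) = begin
  suc (suc k) * (suc (suc n) C suc (suc k))
    ≡⟨ cong (suc (suc k) *_) (nCk+nC[k+1]≡[n+1]C[k+1] (suc n) (suc k)) ⟨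
  suc (suc k) * (suc n C suc k + suc n C suc (suc k))
    ≡⟨ *-distribˡ-+ (suc (suc k)) (suc n C suc k) _ ⟩
  suc n C suc k + suc k * (suc n C suc k) + suc (suc k) * (suc n C suc (suc k))
    ≡⟨ cong₂ (λ x y → suc n C suc k + x + y)
             ([k+1]*[n+1]C[k+1]≡[n+1]*nCk n k) ([k+1]*[n+1]C[k+1]≡[n+1]*nCk n (suc k)) ⟩
  suc n C suc k + suc n * (n C k) + suc n * (n C suc k)
    ≡⟨ +-assoc (suc n C suc k) _ _ ⟩
  suc n C suc k + (suc n * (n C k) + suc n * (n C suc k))
    ≡⟨ cong (suc n C suc k +_) (*-distribˡ-+ (suc n) (n C k) _) ⟨
  suc n C suc k + suc n * (n C k + n C suc k)
    ≡⟨ cong (λ x → suc n C suc k + suc n * x) (nCk+nC[k+1]≡[n+1]C[k+1] n k) ⟩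
  suc (suc n) * (suc n C suc k) ∎
  where open ≡-Reasoning

shift : ℕ → (ℕ → ℕ → ℕ) → ℕ → ℕ → ℕ → ℕ
shift c X zero    a p       = X a p
shift c X (suc κ) a zero    = 0
shift c X (suc κ) a (suc p) = shift c X κ (a + c) p

shift-+ : ∀ c X κ a q → shift c X κ a (κ + q) ≡ X (a + κ * c) q
shift-+ c X zero    a q = cong (λ b → X b q) (sym (+-identityʳ a))
shift-+ c X (suc κ) a q = trans (shift-+ c X κ (a + c) q) (cong (λ b → X b q) (+-assoc a c (κ * c)))

shift-< : ∀ c X κ a p → p < κ → shift c X κ a p ≡ 0
shift-< c X (suc κ) a zero    _         = refl
shift-< c X (suc κ) a (suc p) (s≤s p<κ) = shift-< c X κ (a + c) p p<κ

shift-shift-< : ∀ c c′ X k ℓ a p → p < ℓ + k → shift c (shift c′ X k) ℓ a p ≡ 0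
shift-shift-< c c′ X k zero    a p       p<k        = shift-< c′ X k a p p<k
shift-shift-< c c′ X k (suc ℓ) a zero    _          = refl
shift-shift-< c c′ X k (suc ℓ) a (suc p) (s≤s p<ℓ+k) = shift-shift-< c c′ X k ℓ (a + c) p p<ℓ+k

module _ {d : ℕ} where

  leaf : Tree d
  leaf = node []

  outdeg : Tree d → ℕ
  outdeg (node ts) = length ts

  addTuplet : Vec (Tree d) d → Tree d → Tree d
  addTuplet v (node ts) = node (v ∷ ts)

  outdeg-addTuplet : ∀ v t → outdeg (addTuplet v t) ≡ suc (outdeg t)
  outdeg-addTuplet v (node ts) = refl

  mutual
    vertices-suc : ∀ (t : Tree d) l → vertices t (suc l) ≡ map (map₂ suc) (vertices t l)
    vertices-suc (node ts) l = cong ((length ts , suc l) ∷_) (verticesL-suc ts (suc l))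

    verticesL-suc : ∀ (ts : List (Vec (Tree d) d)) l → verticesL ts (suc l) ≡ map (map₂ suc) (verticesL ts l)
    verticesL-suc []       l = refl
    verticesL-suc (v ∷ ts) l =
      trans (cong₂ _++_ (verticesV-suc v l) (verticesL-suc ts l)) (sym (map-++ _ (verticesV v l) _))

    verticesV-suc : ∀ {m} (v : Vec (Tree d) m) l → verticesV v (suc l) ≡ map (map₂ suc) (verticesV v l)
    verticesV-suc []      l = refl
    verticesV-suc (t ∷ v) l =
      trans (cong₂ _++_ (vertices-suc t l) (verticesV-suc v l)) (sym (map-++ _ (vertices t l) _))

  module _ (k ℓ : ℕ) where

    weight-++ : ∀ xs ys → weight k ℓ (xs ++ ys) ≡ weight k ℓ xs + weight k ℓ ys
    weight-++ xs ys = trans (cong sum (map-++ _ xs ys)) (sum-++ (map (vertexWeight k ℓ) xs) _)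

    weight-verticesV : ∀ {m} (v : Vec (Tree d) m) →
                       weight k ℓ (verticesV v 0) ≡ sum (tabulate (λ j → countVerts k ℓ (V.lookup v j)))
    weight-verticesV []      = refl
    weight-verticesV (t ∷ v) = trans (weight-++ (vertices t 0) _)
                                     (cong₂ _+_ (sym (countVerts≡weight k ℓ t)) (weight-verticesV v))

  weight-map-suc : ∀ k ℓ xs → weight k ℓ (map (map₂ suc) xs) ≡ weight k (ℓ ∸ 1) xs
  weight-map-suc k ℓ xs = trans (cong sum (sym (map-∘ xs)))
                                (cong sum (map-cong (λ { (o , l) → cong (_* atLeast k o) (atLeast-suc ℓ l) }) xs))

  countVerts-node : ∀ k ℓ ts →
    countVerts k ℓ (node ts) ≡ atLeast ℓ 0 * atLeast k (length ts) + weight k (ℓ ∸ 1) (verticesL ts 0)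
  countVerts-node k ℓ ts = trans (countVerts≡weight k ℓ (node ts))
    (cong (atLeast ℓ 0 * atLeast k (length ts) +_)
      (trans (cong (weight k ℓ) (verticesL-suc ts 0)) (weight-map-suc k ℓ (verticesL ts 0))))

  countVerts-addTuplet : ∀ k ℓ v t →
    countVerts k ℓ (addTuplet v t) + atLeast ℓ 0 * atLeast k (outdeg t)
      ≡ atLeast ℓ 0 * atLeast k (suc (outdeg t)) + sum (tabulate (λ j → countVerts k (ℓ ∸ 1) (V.lookup v j)))
        + countVerts k ℓ t
  countVerts-addTuplet k ℓ v (node ts) = begin
    countVerts k ℓ (node (v ∷ ts)) + root (length ts)
      ≡⟨ cong (_+ root (length ts)) (countVerts-node k ℓ (v ∷ ts)) ⟩
    root (suc (length ts)) + weight k (ℓ ∸ 1) (verticesV v 0 ++ verticesL ts 0) + root (length ts)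
      ≡⟨ cong (λ x → root (suc (length ts)) + x + root (length ts))
              (trans (weight-++ k (ℓ ∸ 1) (verticesV v 0) _) (cong (_+ below) (weight-verticesV k (ℓ ∸ 1) v))) ⟩
    root (suc (length ts)) + (children + below) + root (length ts)
      ≡⟨ rearrange (root (suc (length ts))) children below (root (length ts)) ⟩
    root (suc (length ts)) + children + (root (length ts) + below)
      ≡⟨ cong (root (suc (length ts)) + children +_) (countVerts-node k ℓ ts) ⟨
    root (suc (length ts)) + children + countVerts k ℓ (node ts) ∎
    where
      open ≡-Reasoning
      root = λ o → atLeast ℓ 0 * atLeast k o
      children = sum (tabulate (λ j → countVerts k (ℓ ∸ 1) (V.lookup v j)))
      below = weight k (ℓ ∸ 1) (verticesL ts 0)
      rearrange : ∀ a b c e → a + (b + c) + e ≡ a + b + (e + c)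
      rearrange = solve-∀

module Forests (d : ℕ) where

  graft : ∀ {m} → Vec (Tree d) d → Vec (Tree d) (suc m) → Vec (Tree d) (suc m)
  graft v (t ∷ g) = addTuplet v t ∷ g

  -- The d trees of the new tuplet are taken from the end, so that the source forest has
  -- suc m + d = suc (m + d) trees and the positions of the other trees do not move.
  regroup : ∀ {m} → Vec (Tree d) (suc m + d) → Vec (Tree d) (suc m)
  regroup {m} w = graft (V.drop (suc m) w) (V.take (suc m) w)

  forests : (m p : ℕ) → List (Vec (Tree d) m)
  forests zero    zero    = [] ∷ []
  forests zero    (suc p) = []
  forests (suc m) zero    = map (leaf ∷_) (forests m zero)
  forests (suc m) (suc p) = map (leaf ∷_) (forests m (suc p)) ++ map regroup (forests (suc m + d) p)

  regroup-++ : ∀ {m} (u : Vec (Tree d) (suc m)) (v : Vec (Tree d) d) → regroup (u V.++ v) ≡ graft v u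
  regroup-++ u v with take-drop-++ u v
  ... | take≡u , drop≡v = cong₂ graft drop≡v take≡u

  graft-injective : ∀ {m} {v v' : Vec (Tree d) d} {u u' : Vec (Tree d) (suc m)} →
                    graft v u ≡ graft v' u' → u ≡ u' × v ≡ v'
  graft-injective {u = node ts ∷ g} {u' = node ts ∷ g} refl = refl , refl

  regroup-injective : ∀ {m} {w w' : Vec (Tree d) (suc m + d)} → regroup w ≡ regroup w' → w ≡ w'
  regroup-injective {m} {w} {w'} eq with graft-injective eq
  ... | take≡ , drop≡ = begin
    w                                        ≡⟨ take++drop≡id (suc m) w ⟨
    V.take (suc m) w V.++ V.drop (suc m) w   ≡⟨ cong₂ V._++_ take≡ drop≡ ⟩
    V.take (suc m) w' V.++ V.drop (suc m) w' ≡⟨ take++drop≡id (suc m) w' ⟩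
    w'                                       ∎
    where open ≡-Reasoning

  tupletsV-++ : ∀ {m n} (u : Vec (Tree d) m) (v : Vec (Tree d) n) → tupletsV (u V.++ v) ≡ tupletsV u + tupletsV v
  tupletsV-++ [] v = refl
  tupletsV-++ (t ∷ u) v = trans (cong (tuplets t +_) (tupletsV-++ u v)) (sym (+-assoc (tuplets t) _ _))

  tupletsV-graft : ∀ {m} (v : Vec (Tree d) d) (u : Vec (Tree d) (suc m)) → tupletsV (graft v u) ≡ suc (tupletsV (u V.++ v))
  tupletsV-graft v (node ts ∷ g) =
    cong suc (trans (rotate (tupletsV v) (tupletsL ts) (tupletsV g)) (sym (tupletsV-++ (node ts ∷ g) v)))
    where
      rotate : ∀ x y z → x + y + z ≡ y + z + x
      rotate = solve-∀

  tupletsV-regroup : ∀ {m} (w : Vec (Tree d) (suc m + d)) → tupletsV (regroup w) ≡ suc (tupletsV w)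
  tupletsV-regroup {m} w = trans (tupletsV-graft (V.drop (suc m) w) (V.take (suc m) w))
                                 (cong (suc ∘ tupletsV) (take++drop≡id (suc m) w))

  forests-sound : ∀ m p → All (λ f → tupletsV f ≡ p) (forests m p)
  forests-sound zero    zero    = refl ∷ []
  forests-sound zero    (suc p) = []
  forests-sound (suc m) zero    = All.map⁺ (forests-sound m zero)
  forests-sound (suc m) (suc p) =
    All.++⁺ (All.map⁺ (forests-sound m (suc p)))
            (All.map⁺ (All.map (λ {w} eq → trans (tupletsV-regroup w) (cong suc eq)) (forests-sound (suc m + d) p)))

  forests-complete : ∀ m p (f : Vec (Tree d) m) → tupletsV f ≡ p → f ∈ forests m p
  forests-complete zero    zero    []                    _  = here refl
  forests-complete (suc m) zero    (node [] ∷ g)         eq = ∈-map⁺ (leaf ∷_) (forests-complete m zero g eq)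
  forests-complete (suc m) (suc p) (node [] ∷ g)         eq =
    ∈-++⁺ˡ (∈-map⁺ (leaf ∷_) (forests-complete m (suc p) g eq))
  forests-complete (suc m) (suc p) (node (v ∷ ts) ∷ g)  eq =
    ∈-++⁺ʳ (map (leaf ∷_) (forests m (suc p)))
      (subst (_∈ map regroup (forests (suc m + d) p)) (regroup-++ (node ts ∷ g) v)
        (∈-map⁺ regroup (forests-complete (suc m + d) p w (suc-injective tuplets-w))))
    where
      w = (node ts ∷ g) V.++ v
      tuplets-w : suc (tupletsV w) ≡ suc p
      tuplets-w = trans (sym (tupletsV-graft v (node ts ∷ g))) eq

  regroup≢leaf∷ : ∀ {m} (w : Vec (Tree d) (suc m + d)) f → regroup w ≢ leaf ∷ f
  regroup≢leaf∷ (node ts ∷ w) f ()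

  forests-unique : ∀ m p → Unique (forests m p)
  forests-unique zero    zero    = [] ∷ []
  forests-unique zero    (suc p) = []
  forests-unique (suc m) zero    = Unique.map⁺ ∷-injectiveʳ (forests-unique m zero)
  forests-unique (suc m) (suc p) =
    Unique.++⁺ (Unique.map⁺ ∷-injectiveʳ (forests-unique m (suc p)))
               (Unique.map⁺ regroup-injective (forests-unique (suc m + d) p))
               leaf-first-disjoint
    where
      leaf-first-disjoint : Disjoint (map (leaf ∷_) (forests m (suc p))) (map regroup (forests (suc m + d) p))
      leaf-first-disjoint (f∈₁ , f∈₂) with ∈-map⁻ (leaf ∷_) f∈₁ | ∈-map⁻ regroup f∈₂
      ... | f , _ , refl | w , _ , eq = regroup≢leaf∷ w f (sym eq)

  forestSum : ∀ m → ℕ → (Vec (Tree d) m → ℕ) → ℕ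
  forestSum m p g = sum (map g (forests m p))

  #forests : ℕ → ℕ → ℕ
  #forests m p = length (forests m p)

  forestSum-cong : ∀ m p {g h : Vec (Tree d) m → ℕ} → (∀ f → g f ≡ h f) → forestSum m p g ≡ forestSum m p h
  forestSum-cong m p g≗h = cong sum (map-cong g≗h (forests m p))

  forestSum-suc : ∀ m p (g : Vec (Tree d) (suc m) → ℕ) →
    forestSum (suc m) (suc p) g ≡ forestSum m (suc p) (g ∘ (leaf ∷_)) + forestSum (suc m + d) p (g ∘ regroup)
  forestSum-suc m p g = begin
    sum (map g (leafFirst ++ regrouped))           ≡⟨ cong sum (map-++ g leafFirst regrouped) ⟩
    sum (map g leafFirst ++ map g regrouped)       ≡⟨ sum-++ (map g leafFirst) _ ⟩
    sum (map g leafFirst) + sum (map g regrouped)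
      ≡⟨ cong₂ _+_ (cong sum (map-∘ (forests m (suc p)))) (cong sum (map-∘ (forests (suc m + d) p))) ⟨
    forestSum m (suc p) (g ∘ (leaf ∷_)) + forestSum (suc m + d) p (g ∘ regroup) ∎
    where
      open ≡-Reasoning
      leafFirst = map (leaf ∷_) (forests m (suc p))
      regrouped = map regroup (forests (suc m + d) p)

  forests-zero : ∀ m → forests m 0 ≡ V.replicate m leaf ∷ []
  forests-zero zero    = refl
  forests-zero (suc m) = cong (map (leaf ∷_)) (forests-zero m)

  forestSum-zero : ∀ m (g : Vec (Tree d) m → ℕ) → forestSum m 0 g ≡ g (V.replicate m leaf)
  forestSum-zero m g = trans (cong (sum ∘ map g) (forests-zero m)) (+-identityʳ _)

  #forests-zero : ∀ m → #forests m 0 ≡ 1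
  #forests-zero m = cong length (forests-zero m)

  #forests-suc : ∀ m p → #forests (suc m) (suc p) ≡ #forests m (suc p) + #forests (suc m + d) p
  #forests-suc m p = trans (length-++ (map (leaf ∷_) (forests m (suc p))))
                           (cong₂ _+_ (length-map _ (forests m (suc p))) (length-map _ (forests (suc m + d) p)))

  forestSum-const : ∀ m p (c : ℕ) → forestSum m p (λ _ → c) ≡ c * #forests m p
  forestSum-const m p c = sum-map-const c (forests m p)

  lookup-regroup-zero : ∀ {m} (w : Vec (Tree d) (suc m + d)) →
                        V.lookup (regroup w) zero ≡ addTuplet (V.drop (suc m) w) (V.lookup w zero)
  lookup-regroup-zero (node ts ∷ w) = refl

  lookup-regroup-suc : ∀ {m} (w : Vec (Tree d) (suc m + d)) (i : Fin m) →
                       V.lookup (regroup w) (suc i) ≡ V.lookup w (suc i ↑ˡ d)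
  lookup-regroup-suc {m} (node ts ∷ w) i = begin
    V.lookup (V.take m w) i                               ≡⟨ lookup-++ˡ (V.take m w) (V.drop m w) i ⟨
    V.lookup (V.take m w V.++ V.drop m w) (i ↑ˡ d)        ≡⟨ cong (λ u → V.lookup u (i ↑ˡ d)) (take++drop≡id m w) ⟩
    V.lookup w (i ↑ˡ d)                                   ∎
    where open ≡-Reasoning

  -- Y a p stands for a sum over the forests with suc a trees and p tuplets; this is the recurrence
  -- of forestSum-suc, the forests with suc (suc a) + d trees being indexed by suc a + d.
  record Recurrence (Y : ℕ → ℕ → ℕ) : Set where
    field
      step : ∀ a p → Y (suc a) (suc p) ≡ Y a (suc p) + Y (suc a + d) p
      base : ∀ a → Y (suc a) 0 ≡ Y a 0

  PositionSums : (Tree d → ℕ) → (ℕ → ℕ → ℕ) → ℕ → Set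
  PositionSums g Y p = ∀ a (i : Fin (suc a)) → forestSum (suc a) p (λ f → g (V.lookup f i)) ≡ Y a p

  position-independence :
    {I : Set} (g : I → Tree d → ℕ) (Y : I → ℕ → ℕ → ℕ) → (∀ x → Recurrence (Y x)) →
    (∀ x a → Y x a 0 ≡ g x leaf) →
    (∀ p → (∀ x → PositionSums (g x) (Y x) p) →
           ∀ x a → forestSum (suc a) (suc p) (λ f → g x (V.lookup f zero)) ≡ Y x a (suc p)) →
    ∀ p x → PositionSums (g x) (Y x) p
  position-independence g Y rec leaf-value head-step = sums
    where
      sums : ∀ p x → PositionSums (g x) (Y x) p
      sums zero x a i = begin
        forestSum (suc a) 0 (λ f → g x (V.lookup f i)) ≡⟨ forestSum-zero (suc a) _ ⟩
        g x (V.lookup (V.replicate (suc a) leaf) i)    ≡⟨ cong (g x) (lookup-replicate i leaf) ⟩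
        g x leaf                                       ≡⟨ leaf-value x a ⟨
        Y x a 0                                        ∎
        where open ≡-Reasoning
      sums (suc p) x a zero = head-step p (sums p) x a
      sums (suc p) x (suc a) (suc i) = begin
        forestSum (suc (suc a)) (suc p) (λ f → g x (V.lookup f (suc i)))
          ≡⟨ forestSum-suc (suc a) p _ ⟩
        forestSum (suc a) (suc p) (λ f → g x (V.lookup f i))
          + forestSum (suc (suc a) + d) p (λ w → g x (V.lookup (regroup w) (suc i)))
          ≡⟨ cong₂ _+_ (sums (suc p) x a i) (forestSum-cong _ p (λ w → cong (g x) (lookup-regroup-suc w i))) ⟩
        Y x a (suc p) + forestSum (suc (suc a) + d) p (λ w → g x (V.lookup w (suc i ↑ˡ d)))
          ≡⟨ cong (Y x a (suc p) +_) (sums p x (suc a + d) (suc i ↑ˡ d)) ⟩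
        Y x a (suc p) + Y x (suc a + d) p
          ≡⟨ Recurrence.step (rec x) a p ⟨
        Y x (suc a) (suc p) ∎
        where open ≡-Reasoning

  shift-recurrence : ∀ c {X} → Recurrence X → ∀ κ → Recurrence (shift c X κ)
  shift-recurrence c rec zero = rec
  shift-recurrence c {X} rec (suc κ) = record { step = step ; base = λ _ → refl }
    where
      open Recurrence (shift-recurrence c rec κ) renaming (step to stepκ; base to baseκ)
      step : ∀ a p → shift c X (suc κ) (suc a) (suc p) ≡ shift c X (suc κ) a (suc p) + shift c X (suc κ) (suc a + d) p
      step a zero    = trans (baseκ (a + c)) (sym (+-identityʳ _))
      step a (suc p) = trans (stepκ (a + c) p)
                             (cong (λ b → shift c X κ (a + c) (suc p) + shift c X κ (suc b) p) (xy∙z≈xz∙y a c d))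

  *-recurrence : ∀ c {X} → Recurrence X → Recurrence (λ a p → c * X a p)
  *-recurrence c rec = record
    { step = λ a p → trans (cong (c *_) (Recurrence.step rec a p)) (*-distribˡ-+ c _ _)
    ; base = λ a → cong (c *_) (Recurrence.base rec a)
    }

  shift-suc-split : ∀ {X} → Recurrence X → ∀ ℓ b p →
                    shift (suc d) X ℓ (suc b) p ≡ shift (suc d) X ℓ b p + shift (suc d) X (suc ℓ) b p
  shift-suc-split rec ℓ b zero    = trans (Recurrence.base (shift-recurrence (suc d) rec ℓ) b) (sym (+-identityʳ _))
  shift-suc-split {X} rec ℓ b (suc p) =
    trans (Recurrence.step (shift-recurrence (suc d) rec ℓ) b p)
          (cong (λ c → shift (suc d) X ℓ b (suc p) + shift (suc d) X ℓ c p) (sym (+-suc b d)))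

  #forests-recurrence : Recurrence (λ a → #forests (suc a))
  #forests-recurrence = record
    { step = λ a → #forests-suc (suc a)
    ; base = λ a → trans (#forests-zero (suc (suc a))) (sym (#forests-zero (suc a)))
    }

  forestSum-head : ∀ a p (g : Tree d → ℕ) →
    forestSum (suc a) (suc p) (λ f → g (V.lookup f zero))
      ≡ g leaf * #forests a (suc p) + forestSum (suc a + d) p (λ w → g (addTuplet (V.drop (suc a) w) (V.lookup w zero)))
  forestSum-head a p g = trans (forestSum-suc a p _)
    (cong₂ _+_ (forestSum-const a (suc p) (g leaf)) (forestSum-cong (suc a + d) p (λ w → cong g (lookup-regroup-zero w))))

  #outdeg≥ : ℕ → ℕ → ℕ → ℕ
  #outdeg≥ = shift d (λ a → #forests (suc a))

  outdegree-sums : ∀ p κ → PositionSums (atLeast κ ∘ outdeg) (#outdeg≥ κ) p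
  outdegree-sums =
    position-independence (λ κ → atLeast κ ∘ outdeg) (#outdeg≥)
                          (shift-recurrence d #forests-recurrence) leaf-value head-step
    where
      leaf-value : ∀ κ a → #outdeg≥ κ a 0 ≡ atLeast κ 0
      leaf-value zero    a = #forests-zero (suc a)
      leaf-value (suc κ) a = refl

      head-step : ∀ p → (∀ κ → PositionSums (atLeast κ ∘ outdeg) (#outdeg≥ κ) p) →
                  ∀ κ a → forestSum (suc a) (suc p) (λ f → atLeast κ (outdeg (V.lookup f zero)))
                            ≡ #outdeg≥ κ a (suc p)
      head-step p sums κ a = begin
        forestSum (suc a) (suc p) (λ f → atLeast κ (outdeg (V.lookup f zero)))
          ≡⟨ forestSum-head a p (atLeast κ ∘ outdeg) ⟩
        atLeast κ 0 * #forests a (suc p)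
          + forestSum (suc a + d) p (λ w → atLeast κ (outdeg (addTuplet (V.drop (suc a) w) (V.lookup w zero))))
          ≡⟨ cong (atLeast κ 0 * #forests a (suc p) +_) (forestSum-cong (suc a + d) p λ w →
               trans (cong (atLeast κ) (outdeg-addTuplet _ (V.lookup w zero))) (atLeast-suc κ _)) ⟩
        atLeast κ 0 * #forests a (suc p) + forestSum (suc a + d) p (λ w → atLeast (κ ∸ 1) (outdeg (V.lookup w zero)))
          ≡⟨ cong (atLeast κ 0 * #forests a (suc p) +_) (sums (κ ∸ 1) (a + d) zero) ⟩
        atLeast κ 0 * #forests a (suc p) + #outdeg≥ (κ ∸ 1) (a + d) p
          ≡⟨ root-split κ ⟩
        #outdeg≥ κ a (suc p) ∎
        where
          open ≡-Reasoning
          root-split : ∀ κ → atLeast κ 0 * #forests a (suc p) + #outdeg≥ (κ ∸ 1) (a + d) p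
                               ≡ #outdeg≥ κ a (suc p)
          root-split zero    = trans (cong (_+ #forests (suc a + d) p) (*-identityˡ _)) (sym (#forests-suc a p))
          root-split (suc κ) = refl

  -- The number of forests with suc a trees and q tuplets, one vertex of the first tree being marked.
  #pointed : ℕ → ℕ → ℕ
  #pointed a q = (suc d * q + a) C q

  #pointed-recurrence : Recurrence #pointed
  #pointed-recurrence = record { step = step ; base = λ _ → refl }
    where
      step : ∀ a p → #pointed (suc a) (suc p) ≡ #pointed a (suc p) + #pointed (suc a + d) p
      step a p = begin
        (suc d * suc p + suc a) C suc p                              ≡⟨ cong (_C suc p) (+-suc (suc d * suc p) a) ⟩
        suc (suc d * suc p + a) C suc p                              ≡⟨ nCk+nC[k+1]≡[n+1]C[k+1] _ p ⟨
        (suc d * suc p + a) C p + (suc d * suc p + a) C suc p        ≡⟨ cong (λ n → n C p + #pointed a (suc p)) (reassociate d p a) ⟩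
        (suc d * p + (suc a + d)) C p + #pointed a (suc p)           ≡⟨ +-comm _ (#pointed a (suc p)) ⟩
        #pointed a (suc p) + #pointed (suc a + d) p                  ∎
        where
          open ≡-Reasoning
          reassociate : ∀ d p a → suc d * suc p + a ≡ suc d * p + (suc a + d)
          reassociate = solve-∀

  mutual
    #pointed-suc : ∀ a p → #forests a (suc p) + suc d * #pointed (a + d) p ≡ #pointed a (suc p)
    #pointed-suc zero p = *-cancelˡ-≡ _ _ (suc p) (begin
      suc p * (suc d * (N C p))      ≡⟨ *-assoc (suc p) (suc d) _ ⟨
      suc p * suc d * (N C p)        ≡⟨ cong (_* (N C p)) (suc-N d p) ⟩
      suc N * (N C p)                ≡⟨ [k+1]*[n+1]C[k+1]≡[n+1]*nCk N p ⟨
      suc p * (suc N C suc p)        ≡⟨ cong (λ n → suc p * (n C suc p)) (sym (suc-N′ d p)) ⟩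
      suc p * #pointed zero (suc p)  ∎)
      where
        open ≡-Reasoning
        N = suc d * p + d
        suc-N : ∀ d p → suc p * suc d ≡ suc (suc d * p + d)
        suc-N = solve-∀
        suc-N′ : ∀ d p → suc d * suc p + 0 ≡ suc (suc d * p + d)
        suc-N′ = solve-∀
    #pointed-suc (suc a) p = begin
      #forests (suc a) (suc p) + suc d * #pointed (suc a + d) p
        ≡⟨ cong (_+ suc d * #pointed (suc a + d) p) (#forests-suc a p) ⟩
      #forests a (suc p) + #forests (suc a + d) p + (#pointed (suc a + d) p + d * #pointed (suc a + d) p)
        ≡⟨ rearrange (#forests a (suc p)) (#forests (suc a + d) p) (#pointed (suc a + d) p) _ ⟩
      #forests a (suc p) + (#forests (suc a + d) p + d * #pointed (suc a + d) p) + #pointed (suc a + d) p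
        ≡⟨ cong (λ x → #forests a (suc p) + x + #pointed (suc a + d) p) (#forests+#pointed (a + d) p) ⟩
      #forests a (suc p) + suc d * #pointed (a + d) p + #pointed (suc a + d) p
        ≡⟨ cong (_+ #pointed (suc a + d) p) (#pointed-suc a p) ⟩
      #pointed a (suc p) + #pointed (suc a + d) p
        ≡⟨ Recurrence.step #pointed-recurrence a p ⟨
      #pointed (suc a) (suc p) ∎
      where
        open ≡-Reasoning
        rearrange : ∀ x y z u → x + y + (z + u) ≡ x + (y + u) + z
        rearrange = solve-∀

    #forests+#pointed : ∀ a p → #forests (suc a) p + d * #pointed (suc a) p ≡ suc d * #pointed a p
    #forests+#pointed a zero    = cong (λ x → x + d * 1) (#forests-zero (suc a))
    #forests+#pointed a (suc p) = +-cancelʳ-≡ (suc d * Y) _ _ (begin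
      #forests (suc a) (suc p) + d * #pointed (suc a) (suc p) + suc d * Y
        ≡⟨ xy∙z≈xz∙y (#forests (suc a) (suc p)) _ _ ⟩
      #forests (suc a) (suc p) + suc d * Y + d * #pointed (suc a) (suc p)
        ≡⟨ cong (_+ d * #pointed (suc a) (suc p)) (#pointed-suc (suc a) p) ⟩
      suc d * #pointed (suc a) (suc p)
        ≡⟨ cong (suc d *_) (Recurrence.step #pointed-recurrence a p) ⟩
      suc d * (#pointed a (suc p) + Y)
        ≡⟨ *-distribˡ-+ (suc d) (#pointed a (suc p)) Y ⟩
      suc d * #pointed a (suc p) + suc d * Y ∎)
      where
        open ≡-Reasoning
        Y = #pointed (suc a + d) p

  #pointedOutdeg≥ : ℕ → ℕ → ℕ → ℕ
  #pointedOutdeg≥ = shift d #pointed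

  #pointedOutdeg≥-suc : ∀ κ a p → #pointedOutdeg≥ κ a p + #outdeg≥ (suc κ) a p
                                    ≡ #outdeg≥ κ a p + suc d * #pointedOutdeg≥ (suc κ) a p
  #pointedOutdeg≥-suc zero    a zero    = cong₂ _+_ (sym (#forests-zero (suc a))) (sym (*-zeroʳ (suc d)))
  #pointedOutdeg≥-suc zero    a (suc p) = begin
    #pointed a (suc p) + #forests (suc a + d) p
      ≡⟨ cong (_+ #forests (suc a + d) p) (#pointed-suc a p) ⟨
    #forests a (suc p) + suc d * #pointed (a + d) p + #forests (suc a + d) p
      ≡⟨ xy∙z≈xz∙y (#forests a (suc p)) _ _ ⟩
    #forests a (suc p) + #forests (suc a + d) p + suc d * #pointed (a + d) p
      ≡⟨ cong (_+ suc d * #pointed (a + d) p) (#forests-suc a p) ⟨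
    #forests (suc a) (suc p) + suc d * #pointed (a + d) p ∎
    where open ≡-Reasoning
  #pointedOutdeg≥-suc (suc κ) a zero    = sym (*-zeroʳ (suc d))
  #pointedOutdeg≥-suc (suc κ) a (suc p) = #pointedOutdeg≥-suc κ (a + d) p

  #pointedOutdeg≥-head : ∀ k a p → #pointedOutdeg≥ k a (suc p) + #outdeg≥ k (a + d) p
    ≡ atLeast k 0 * #forests a (suc p) + #outdeg≥ (k ∸ 1) (a + d) p + suc d * #pointedOutdeg≥ k (a + d) p
  #pointedOutdeg≥-head zero a p =
    trans (#pointedOutdeg≥-suc zero a (suc p))
          (cong (_+ suc d * #pointed (a + d) p)
                (trans (#forests-suc a p) (cong (_+ #forests (suc a + d) p) (sym (*-identityˡ (#forests a (suc p)))))))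
  #pointedOutdeg≥-head (suc κ) a p = #pointedOutdeg≥-suc κ (a + d) p

  forestSum-new-tuplet : ∀ g Y p → PositionSums g Y p → ∀ a →
    forestSum (suc a + d) p (λ w → sum (tabulate (λ j → g (V.lookup (V.drop (suc a) w) j)))) ≡ d * Y (a + d) p
  forestSum-new-tuplet g Y p sums a = begin
    forestSum (suc a + d) p (λ w → sum (tabulate (λ j → g (V.lookup (V.drop (suc a) w) j))))
      ≡⟨ forestSum-cong (suc a + d) p (λ w → cong sum (tabulate-cong (λ j → cong g (lookup-drop (suc a) w j)))) ⟩
    forestSum (suc a + d) p (λ w → sum (tabulate (λ j → g (V.lookup w (suc a ↑ʳ j)))))
      ≡⟨ sum-map-tabulate-comm d (λ w j → g (V.lookup w (suc a ↑ʳ j))) (forests (suc a + d) p) ⟩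
    sum (tabulate (λ j → forestSum (suc a + d) p (λ w → g (V.lookup w (suc a ↑ʳ j)))))
      ≡⟨ cong sum (tabulate-cong (λ j → sums (a + d) (suc a ↑ʳ j))) ⟩
    sum (tabulate {n = d} (λ _ → Y (a + d) p))
      ≡⟨ sum-tabulate-const d (Y (a + d) p) ⟩
    d * Y (a + d) p ∎
    where open ≡-Reasoning

  -- The number of vertices of outdegree ≥ k and level ≥ ℓ in a fixed tree, summed over the forests
  -- with suc a trees and p tuplets.
  #marked : ℕ → ℕ → ℕ → ℕ → ℕ
  #marked k ℓ a p = d ^ ℓ * shift (suc d) (#pointedOutdeg≥ k) ℓ a p

  #marked-recurrence : ∀ k ℓ → Recurrence (#marked k ℓ)
  #marked-recurrence k ℓ = *-recurrence (d ^ ℓ) (shift-recurrence (suc d) (shift-recurrence d #pointed-recurrence k) ℓ)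

  countVerts-leaf : ∀ k ℓ → countVerts k ℓ (leaf {d}) ≡ atLeast ℓ 0 * atLeast k 0
  countVerts-leaf k ℓ = trans (countVerts≡weight k ℓ (leaf {d})) (+-identityʳ _)

  #marked-leaf : ∀ k ℓ a → #marked k ℓ a 0 ≡ countVerts k ℓ (leaf {d})
  #marked-leaf zero    zero    a = sym (countVerts-leaf 0 0)
  #marked-leaf (suc k) zero    a = sym (countVerts-leaf (suc k) 0)
  #marked-leaf k       (suc ℓ) a = trans (*-zeroʳ (d ^ suc ℓ)) (sym (countVerts-leaf k (suc ℓ)))

  #marked-head-suc : ∀ k ℓ p → PositionSums (countVerts k ℓ) (#marked k ℓ) p →
                     PositionSums (countVerts k (suc ℓ)) (#marked k (suc ℓ)) p → ∀ a →
                     forestSum (suc a) (suc p) (λ f → countVerts k (suc ℓ) (V.lookup f zero)) ≡ #marked k (suc ℓ) a (suc p)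
  #marked-head-suc k ℓ p sums-ℓ sums-sucℓ a = begin
    forestSum (suc a) (suc p) (λ f → countVerts k (suc ℓ) (V.lookup f zero))
      ≡⟨ forestSum-head a p (countVerts k (suc ℓ)) ⟩
    countVerts k (suc ℓ) (leaf {d}) * #forests a (suc p) + forestSum (suc a + d) p (λ w → countVerts k (suc ℓ) (graftedRoot w))
      ≡⟨ cong₂ _+_ (cong (_* #forests a (suc p)) (countVerts-leaf k (suc ℓ)))
                   (forestSum-cong (suc a + d) p (λ w →
                      trans (sym (+-identityʳ _)) (countVerts-addTuplet k (suc ℓ) _ (V.lookup w zero)))) ⟩
    forestSum (suc a + d) p (λ w → children w + countVerts k (suc ℓ) (V.lookup w zero))
      ≡⟨ sum-map-+ children _ (forests (suc a + d) p) ⟩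
    forestSum (suc a + d) p children + forestSum (suc a + d) p (λ w → countVerts k (suc ℓ) (V.lookup w zero))
      ≡⟨ cong₂ _+_ (forestSum-new-tuplet (countVerts k ℓ) (#marked k ℓ) p sums-ℓ a) (sums-sucℓ (a + d) zero) ⟩
    d * (d ^ ℓ * G ℓ (a + d) p) + d ^ suc ℓ * G (suc ℓ) (a + d) p
      ≡⟨ cong (_+ d ^ suc ℓ * G (suc ℓ) (a + d) p) (*-assoc d (d ^ ℓ) _) ⟨
    d ^ suc ℓ * G ℓ (a + d) p + d ^ suc ℓ * G (suc ℓ) (a + d) p
      ≡⟨ *-distribˡ-+ (d ^ suc ℓ) _ _ ⟨
    d ^ suc ℓ * (G ℓ (a + d) p + G (suc ℓ) (a + d) p)
      ≡⟨ cong (d ^ suc ℓ *_) (shift-suc-split (shift-recurrence d #pointed-recurrence k) ℓ (a + d) p) ⟨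
    d ^ suc ℓ * G ℓ (suc (a + d)) p
      ≡⟨ cong (λ b → d ^ suc ℓ * G ℓ b p) (+-suc a d) ⟨
    #marked k (suc ℓ) a (suc p) ∎
    where
      open ≡-Reasoning
      G = shift (suc d) (#pointedOutdeg≥ k)
      graftedRoot : Vec (Tree d) (suc a + d) → Tree d
      graftedRoot w = addTuplet (V.drop (suc a) w) (V.lookup w zero)
      children : Vec (Tree d) (suc a + d) → ℕ
      children w = sum (tabulate (λ j → countVerts k ℓ (V.lookup (V.drop (suc a) w) j)))

  forestSum-graftedRoot : ∀ k p → PositionSums (countVerts k 0) (#marked k 0) p → ∀ a →
    forestSum (suc a + d) p (λ w → countVerts k 0 (addTuplet (V.drop (suc a) w) (V.lookup w zero))) + #outdeg≥ k (a + d) p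
      ≡ #outdeg≥ (k ∸ 1) (a + d) p + suc d * #pointedOutdeg≥ k (a + d) p
  forestSum-graftedRoot k p sums a = begin
    forestSum (suc a + d) p grafted + #outdeg≥ k (a + d) p
      ≡⟨ cong (forestSum (suc a + d) p grafted +_) (outdegree-sums p k (a + d) zero) ⟨
    forestSum (suc a + d) p grafted + forestSum (suc a + d) p rootDegree
      ≡⟨ sum-map-+ grafted rootDegree (forests (suc a + d) p) ⟨
    forestSum (suc a + d) p (λ w → grafted w + rootDegree w)
      ≡⟨ forestSum-cong (suc a + d) p split-root ⟩
    forestSum (suc a + d) p (λ w → rootDegree′ w + children w + countVerts k 0 (V.lookup w zero))
      ≡⟨ trans (sum-map-+ (λ w → rootDegree′ w + children w) _ (forests (suc a + d) p))
               (cong (_+ forestSum (suc a + d) p (λ w → countVerts k 0 (V.lookup w zero)))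
                     (sum-map-+ rootDegree′ children (forests (suc a + d) p))) ⟩
    forestSum (suc a + d) p rootDegree′ + forestSum (suc a + d) p children
      + forestSum (suc a + d) p (λ w → countVerts k 0 (V.lookup w zero))
      ≡⟨ cong₂ _+_ (cong₂ _+_ (outdegree-sums p (k ∸ 1) (a + d) zero)
                              (forestSum-new-tuplet (countVerts k 0) (#marked k 0) p sums a))
                   (sums (a + d) zero) ⟩
    #outdeg≥ (k ∸ 1) (a + d) p + d * (1 * S) + 1 * S
      ≡⟨ cong (λ x → #outdeg≥ (k ∸ 1) (a + d) p + d * x + x) (*-identityˡ S) ⟩
    #outdeg≥ (k ∸ 1) (a + d) p + d * S + S
      ≡⟨ trans (+-assoc (#outdeg≥ (k ∸ 1) (a + d) p) _ _) (cong (#outdeg≥ (k ∸ 1) (a + d) p +_) (+-comm (d * S) S)) ⟩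
    #outdeg≥ (k ∸ 1) (a + d) p + suc d * S ∎
    where
      open ≡-Reasoning
      S = #pointedOutdeg≥ k (a + d) p
      grafted rootDegree rootDegree′ children : Vec (Tree d) (suc a + d) → ℕ
      grafted w = countVerts k 0 (addTuplet (V.drop (suc a) w) (V.lookup w zero))
      rootDegree w = atLeast k (outdeg (V.lookup w zero))
      rootDegree′ w = atLeast (k ∸ 1) (outdeg (V.lookup w zero))
      children w = sum (tabulate (λ j → countVerts k 0 (V.lookup (V.drop (suc a) w) j)))
      split-root : ∀ w → grafted w + rootDegree w ≡ rootDegree′ w + children w + countVerts k 0 (V.lookup w zero)
      split-root w = begin
        grafted w + rootDegree w
          ≡⟨ cong (grafted w +_) (*-identityˡ (rootDegree w)) ⟨
        grafted w + 1 * rootDegree w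
          ≡⟨ countVerts-addTuplet k 0 (V.drop (suc a) w) (V.lookup w zero) ⟩
        1 * atLeast k (suc (outdeg (V.lookup w zero))) + children w + countVerts k 0 (V.lookup w zero)
          ≡⟨ cong (λ x → x + children w + countVerts k 0 (V.lookup w zero))
                  (trans (*-identityˡ _) (atLeast-suc k (outdeg (V.lookup w zero)))) ⟩
        rootDegree′ w + children w + countVerts k 0 (V.lookup w zero) ∎

  #marked-head-zero : ∀ k p → PositionSums (countVerts k 0) (#marked k 0) p → ∀ a →
                      forestSum (suc a) (suc p) (λ f → countVerts k 0 (V.lookup f zero)) ≡ #marked k 0 a (suc p)
  #marked-head-zero k p sums a = trans (+-cancelʳ-≡ (#outdeg≥ k (a + d) p) _ _ (begin
    forestSum (suc a) (suc p) (λ f → countVerts k 0 (V.lookup f zero)) + #outdeg≥ k (a + d) p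
      ≡⟨ cong (_+ #outdeg≥ k (a + d) p) (forestSum-head a p (countVerts k 0)) ⟩
    countVerts k 0 (leaf {d}) * #forests a (suc p) + grafted + #outdeg≥ k (a + d) p
      ≡⟨ +-assoc (countVerts k 0 (leaf {d}) * #forests a (suc p)) grafted _ ⟩
    countVerts k 0 (leaf {d}) * #forests a (suc p) + (grafted + #outdeg≥ k (a + d) p)
      ≡⟨ cong₂ _+_ (cong (_* #forests a (suc p)) (trans (countVerts-leaf k 0) (*-identityˡ _)))
                   (forestSum-graftedRoot k p sums a) ⟩
    atLeast k 0 * #forests a (suc p) + (#outdeg≥ (k ∸ 1) (a + d) p + suc d * #pointedOutdeg≥ k (a + d) p)
      ≡⟨ +-assoc (atLeast k 0 * #forests a (suc p)) _ _ ⟨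
    atLeast k 0 * #forests a (suc p) + #outdeg≥ (k ∸ 1) (a + d) p + suc d * #pointedOutdeg≥ k (a + d) p
      ≡⟨ #pointedOutdeg≥-head k a p ⟨
    #pointedOutdeg≥ k a (suc p) + #outdeg≥ k (a + d) p ∎)) (sym (*-identityˡ _))
    where
      open ≡-Reasoning
      grafted = forestSum (suc a + d) p (λ w → countVerts k 0 (addTuplet (V.drop (suc a) w) (V.lookup w zero)))

  vertex-sums : ∀ k p ℓ → PositionSums (countVerts k ℓ) (#marked k ℓ) p
  vertex-sums k = position-independence (countVerts k) (#marked k) (#marked-recurrence k) (#marked-leaf k) head-step
    where
      head-step : ∀ p → (∀ ℓ → PositionSums (countVerts k ℓ) (#marked k ℓ) p) →
                  ∀ ℓ a → forestSum (suc a) (suc p) (λ f → countVerts k ℓ (V.lookup f zero)) ≡ #marked k ℓ a (suc p)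
      head-step p sums zero    = #marked-head-zero k p (sums zero)
      head-step p sums (suc ℓ) = #marked-head-suc k ℓ p (sums ℓ) (sums (suc ℓ))

  shift-#pointedOutdeg≥-+ : ∀ k ℓ q → shift (suc d) (#pointedOutdeg≥ k) ℓ 0 (ℓ + (k + q))
                                       ≡ ((1 + d) * (ℓ + (k + q)) ∸ k) C (d * (ℓ + (k + q)) + ℓ)
  shift-#pointedOutdeg≥-+ k ℓ q = begin
    shift (suc d) (#pointedOutdeg≥ k) ℓ 0 (ℓ + (k + q))  ≡⟨ shift-+ (suc d) (#pointedOutdeg≥ k) ℓ 0 (k + q) ⟩
    #pointedOutdeg≥ k (0 + ℓ * suc d) (k + q)             ≡⟨ shift-+ d #pointed k (0 + ℓ * suc d) q ⟩
    W C q                                                ≡⟨ nCk≡nC[n∸k] (subst (q ≤_) (sym (W≡q+bottom d k ℓ q)) (m≤m+n q _)) ⟩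
    W C (W ∸ q)                                          ≡⟨ cong₂ _C_ top≡W bottom≡W∸q ⟨
    ((1 + d) * (ℓ + (k + q)) ∸ k) C (d * (ℓ + (k + q)) + ℓ) ∎
    where
      open ≡-Reasoning
      W = suc d * q + (0 + ℓ * suc d + k * d)
      W≡q+bottom : ∀ d k ℓ q → suc d * q + (0 + ℓ * suc d + k * d) ≡ q + (d * (ℓ + (k + q)) + ℓ)
      W≡q+bottom = solve-∀
      top+k : ∀ d k ℓ q → (1 + d) * (ℓ + (k + q)) ≡ suc d * q + (0 + ℓ * suc d + k * d) + k
      top+k = solve-∀
      top≡W : (1 + d) * (ℓ + (k + q)) ∸ k ≡ W
      top≡W = trans (cong (_∸ k) (top+k d k ℓ q)) (m+n∸n≡m W k)
      bottom≡W∸q : d * (ℓ + (k + q)) + ℓ ≡ W ∸ q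
      bottom≡W∸q = trans (sym (m+n∸m≡n q _)) (cong (_∸ q) (sym (W≡q+bottom d k ℓ q)))

  shift-#pointedOutdeg≥-single-tree : ∀ k ℓ n → 1 ≤ d → 1 ≤ n →
                       shift (suc d) (#pointedOutdeg≥ k) ℓ 0 n ≡ ((1 + d) * n ∸ k) C (d * n + ℓ)
  shift-#pointedOutdeg≥-single-tree k ℓ n 1≤d 1≤n with ℓ + k ≤? n
  ... | no n≱ℓ+k = trans (shift-shift-< (suc d) d #pointed k ℓ 0 n n<ℓ+k) (sym (k>n⇒nCk≡0 top<bottom))
    where
      n<ℓ+k = ≰⇒> n≱ℓ+k
      0<bottom : 0 < d * n + ℓ
      0<bottom = ≤-trans (*-mono-≤ 1≤d 1≤n) (m≤m+n (d * n) ℓ)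
      top<bottom : (1 + d) * n ∸ k < d * n + ℓ
      top<bottom = m<n+o⇒m∸n<o ((1 + d) * n) k {{>-nonZero 0<bottom}}
        (subst₂ _<_ (+-comm (d * n) n) (rearrange d n ℓ k) (+-monoʳ-< (d * n) n<ℓ+k))
        where
          rearrange : ∀ d n ℓ k → d * n + (ℓ + k) ≡ k + (d * n + ℓ)
          rearrange = solve-∀
  ... | yes ℓ+k≤n = subst (λ n → shift (suc d) (#pointedOutdeg≥ k) ℓ 0 n ≡ ((1 + d) * n ∸ k) C (d * n + ℓ))
                          (trans (sym (+-assoc ℓ k q)) (m+[n∸m]≡n ℓ+k≤n)) (shift-#pointedOutdeg≥-+ k ℓ q)
    where q = n ∸ (ℓ + k)

  treesOfSize : ℕ → List (Tree d)
  treesOfSize n = map (λ f → V.lookup f zero) (forests 1 n)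

  ∈-treesOfSize : ∀ n {T} → (T ∈ treesOfSize n) ⇔ (tuplets T ≡ n)
  ∈-treesOfSize n {T} = mk⇔ to from
    where
      to : T ∈ treesOfSize n → tuplets T ≡ n
      to T∈ with ∈-map⁻ (λ f → V.lookup f zero) T∈
      ... | t ∷ [] , f∈ , refl = trans (sym (+-identityʳ (tuplets t))) (All.lookup (forests-sound 1 n) f∈)
      from : tuplets T ≡ n → T ∈ treesOfSize n
      from eq = ∈-map⁺ (λ f → V.lookup f zero) (forests-complete 1 n (T ∷ []) (trans (+-identityʳ (tuplets T)) eq))

  treesOfSize-unique : ∀ n → Unique (treesOfSize n)
  treesOfSize-unique n = Unique.map⁺ singleton-injective (forests-unique 1 n)
    where
      singleton-injective : ∀ {f g : Vec (Tree d) 1} → V.lookup f zero ≡ V.lookup g zero → f ≡ g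
      singleton-injective {_ ∷ []} {_ ∷ []} refl = refl

theorem1p2 : (d n : ℕ) → 1 ≤ d → 1 ≤ n →
    (trees : List (Tree d)) → Unique trees →
    (∀ (T : Tree d) → (T ∈ trees) ⇔ (tuplets T ≡ n)) →
    (k ℓ : ℕ) →
    sum (map (countVerts k ℓ) trees)
    ≡ d ^ ℓ * (((1 + d) * n ∸ k) C (d * n + ℓ))
theorem1p2 d n 1≤d 1≤n trees trees-unique ∈-trees k ℓ = begin
  sum (map (countVerts k ℓ) trees)
    ≡⟨ sum-map-cong-set (countVerts k ℓ) trees-unique (treesOfSize-unique n)
                        (λ {T} → ⇔.trans (∈-trees T) (⇔.sym (∈-treesOfSize n))) ⟩
  sum (map (countVerts k ℓ) (treesOfSize n))
    ≡⟨ cong sum (map-∘ (forests 1 n)) ⟨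
  forestSum 1 n (λ f → countVerts k ℓ (V.lookup f zero))
    ≡⟨ vertex-sums k n ℓ 0 zero ⟩
  d ^ ℓ * shift (suc d) (#pointedOutdeg≥ k) ℓ 0 n
    ≡⟨ cong (d ^ ℓ *_) (shift-#pointedOutdeg≥-single-tree k ℓ n 1≤d 1≤n) ⟩
  d ^ ℓ * (((1 + d) * n ∸ k) C (d * n + ℓ)) ∎
  where
    open Forests d
    open ≡-Reasoning
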